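{- Let $k,\ell\ge 1$ and $\vec{a}=[a_1,\ldots,a_{k\ell}]\in\mathbb{S}_{k,\ell}$, with grid-function $\gamma=\gamma_{\vec{a}}$. Then: (1) If $t_1<t_2$ in $\{1,\ldots,k\ell\}$ and $\gamma(t_q)=(i_q,j_q)$ for $q=1,2$, then $a_{t_1}<a_{t_2}$ implies $j_1<j_2$, and $a_{t_1}>a_{t_2}$ implies $i_1<i_2$. (2) If $i_2\le i_1$, $j_2\le j_1$ and $\gamma(t_q)=(i_q,j_q)$ for $q=1,2$, then $t_2\le t_1$. (3) $R_{\vec{a}}\in\mathbb{Y}_{\ell,k}$. (4) For any $i\in\{1,\ldots,\ell\}$ and $j\in\{1,\ldots,k\}$, the sequence $[a_{\gamma^{ -1}(i,1)},\ldots,a_{\gamma^{ -1}(i,k)}]$ is an increasing subsequence of $\vec{a}$ and the sequence $[a_{\gamma^{ -1}(1,j)},\ldots,a_{\gamma^{ -1}(\ell,j)}]$ is a decreasing subsequence of $\vec{a}$. (5) $V_{\vec{a}}\in\mathbb{Y}_{\ell,k}$. (6) The map $\phi:\mathbb{S}_{k,\ell}\to\mathbb{Y}_{\ell,k}\times\mathbb{Y}_{\ell,k}$, $\phi(\vec{a})=(R_{\vec{a}},V_{\vec{a}})$, is a well-defined injective function.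
   Context: $\mathbb{S}_{k,\ell}$ is the set of permutations $[a_1,\ldots,a_{k\ell}]$ of $\{1,\ldots,k\ell\}$ (as linear sequences) that contain no increasing subsequence of length $k+1$ and no decreasing subsequence of length $\ell+1$. $\mathbb{Y}_{\ell,k}$ is the set of $\ell\times k$ matrices whose set of entries is $\{1,\ldots,k\ell\}$ and in which each row and each column is increasing (standard Young tableaux of rectangular $\ell\times k$ shape). For $\vec{a}\in\mathbb{S}_{k,\ell}$, the grid-function $\gamma_{\vec{a}}:\{1,\ldots,k\ell\}\to\{1,\ldots,\ell\}\times\{1,\ldots,k\}$ is $\gamma_{\vec{a}}(t)=(i,j)$, where $i$ is the length of the longest decreasing subsequence of $\vec{a}$ ending at $a_t$ and $j$ is the length of the longest increasing subsequence of $\vec{a}$ ending at $a_t$; it is a bijection. The grid-ranking $R_{\vec{a}}=(r_{ij})$ and grid-valuation $V_{\vec{a}}=(v_{ij})$ are the $\ell\times k$ matrices with $r_{ij}=\gamma_{\vec{a}}^{ -1}(i,j)$ and $v_{ij}=a_{\gamma_{\vec{a}}^{ -1}(\ell+1-i,j)}$. -}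

module Defs where

open import Data.Nat using (ℕ; zero; suc; _*_; _≤_)
open import Data.Fin using (Fin; toℕ; fromℕ; opposite) renaming (_<_ to _<ᶠ_)
open import Data.Product using (Σ; Σ-syntax; _×_; _,_; proj₁; proj₂)
open import Data.Empty using (⊥)
open import Relation.Nullary using (¬_)
open import Relation.Binary.PropositionalEquality using (_≡_)
open import Function.Definitions using (Bijective)

-- Conventions (0-based encoding): a sequence [a_1,…,a_n] with values in
-- {1,…,n} is a function  a : Fin n → Fin n , position t+1 ↦ value (a t)+1.
-- Since the shift by one is order preserving, all comparisons are on Fin.

IsIncSubseq : ∀ {n m} → (Fin n → Fin n) → (Fin m → Fin n) → Set
IsIncSubseq a s =
  (∀ p q → p <ᶠ q → s p <ᶠ s q) × (∀ p q → p <ᶠ q → a (s p) <ᶠ a (s q))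

IsDecSubseq : ∀ {n m} → (Fin n → Fin n) → (Fin m → Fin n) → Set
IsDecSubseq a s =
  (∀ p q → p <ᶠ q → s p <ᶠ s q) × (∀ p q → p <ᶠ q → a (s q) <ᶠ a (s p))

EndsAt : ∀ {n m} → (Fin m → Fin n) → Fin n → Set
EndsAt {m = zero}  s t = ⊥
EndsAt {m = suc m} s t = s (fromℕ m) ≡ t

IsLongestIncEndingAt : ∀ {n} → (Fin n → Fin n) → Fin n → ℕ → Set
IsLongestIncEndingAt {n} a t i =
  (Σ[ s ∈ (Fin i → Fin n) ] (IsIncSubseq a s × EndsAt s t)) ×
  (∀ m (s : Fin m → Fin n) → IsIncSubseq a s → EndsAt s t → m ≤ i)

IsLongestDecEndingAt : ∀ {n} → (Fin n → Fin n) → Fin n → ℕ → Set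
IsLongestDecEndingAt {n} a t i =
  (Σ[ s ∈ (Fin i → Fin n) ] (IsDecSubseq a s × EndsAt s t)) ×
  (∀ m (s : Fin m → Fin n) → IsDecSubseq a s → EndsAt s t → m ≤ i)

InS : (k ℓ : ℕ) → (Fin (k * ℓ) → Fin (k * ℓ)) → Set
InS k ℓ a =
  Bijective _≡_ _≡_ a ×
  ¬ (Σ[ s ∈ (Fin (suc k) → Fin (k * ℓ)) ] IsIncSubseq a s) ×
  ¬ (Σ[ s ∈ (Fin (suc ℓ) → Fin (k * ℓ)) ] IsDecSubseq a s)

IsGridFunction : ∀ {n} → (Fin n → Fin n) → (Fin n → ℕ × ℕ) → Set
IsGridFunction a γ = ∀ t → IsLongestDecEndingAt a t (proj₁ (γ t))
                         × IsLongestIncEndingAt a t (proj₂ (γ t))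

-- R is the grid-ranking of a (w.r.t. grid-function γ): r_{ij} = γ⁻¹(i,j),
-- i.e. γ (R i j) = (i+1 , j+1) in 0-based grid coordinates.
IsGridRanking : ∀ {n} ℓ k → (Fin n → ℕ × ℕ) → (Fin ℓ → Fin k → Fin n) → Set
IsGridRanking ℓ k γ R = ∀ i j → γ (R i j) ≡ (suc (toℕ i) , suc (toℕ j))

-- grid-valuation from the grid-ranking: v_{ij} = a_{γ⁻¹(ℓ+1-i, j)}
gridValuation : ∀ {n ℓ k} → (Fin n → Fin n) → (Fin ℓ → Fin k → Fin n)
              → Fin ℓ → Fin k → Fin n
gridValuation a R i j = a (R (opposite i) j)

InY : (ℓ k : ℕ) → (Fin ℓ → Fin k → Fin (k * ℓ)) → Set
InY ℓ k M =
  (∀ x → Σ[ i ∈ Fin ℓ ] Σ[ j ∈ Fin k ] M i j ≡ x) ×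
  (∀ i j j' → j <ᶠ j' → M i j <ᶠ M i j') ×
  (∀ i i' j → i <ᶠ i' → M i j <ᶠ M i' j)

module Submission where

-- A subsequence of a that is monotone for a transitive relation
-- on values is a chain for the transitive relation  x ≺ y := x < y ∧ a x ⊏ a y
-- on positions.  For chains over any transitive relation we show that they can
-- be extended past their last entry, that prefixes of chains are chains, and
-- hence that forbidding chains of length K+1 bounds every chain by K.
-- Consequently the longest ⊏-subsequence ending at t₁ can be extended to t₂
-- whenever t₁ < t₂ and a t₁ ⊏ a t₂, so its length grows strictly: this is (1).
-- Part (2) follows from (1) by trichotomy of values (a is injective), and with
-- it injectivity of the grid function γ.  The bounds 1 ≤ γ ≤ (ℓ , k) (from the
-- absence of long monotone subsequences) make γ a bijection onto the grid, so
-- R hits every position; (2) orders R along rows and columns, which gives (3);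
-- (1) forces values to increase along rows and decrease along columns (4);
-- (5) is (4) read through the row reversal, and (6) holds because every
-- position is an entry R i j, where a is recovered as V (opposite i) j.

open import Defs
open import Data.Nat using (ℕ; zero; suc; _*_; _≤_; _<_; _≤?_; z<s; s<s; s<s⁻¹)
import Data.Nat.Properties as ℕ
open import Data.Fin using (Fin; zero; suc; toℕ; fromℕ; fromℕ<; inject≤; opposite)
  renaming (_<_ to _<ᶠ_; _≤_ to _≤ᶠ_)
open import Data.Fin.Properties
  using (_≟_; ≤fromℕ; ≤∧≢⇒<; <-cmp; toℕ-inject≤; toℕ-fromℕ<; toℕ<n;
         opposite-prop; opposite-involutive)
  renaming (<-trans to <ᶠ-trans; ≤-antisym to ≤ᶠ-antisym)
open import Data.Product using (Σ-syntax; _×_; _,_; proj₁; proj₂)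
open import Data.Empty using (⊥-elim)
open import Function using (_∘_; flip)
open import Function.Definitions using (Injective)
open import Relation.Nullary using (¬_; yes; no)
open import Relation.Binary.Definitions using (Transitive; tri<; tri≈; tri>)
open import Relation.Binary.PropositionalEquality
  using (_≡_; refl; sym; trans; cong; cong₂; subst₂; module ≡-Reasoning)

module Chains {A : Set} (_≺_ : A → A → Set) (≺-trans : Transitive _≺_) where

  Chain : ∀ {m} → (Fin m → A) → Set
  Chain s = ∀ p q → p <ᶠ q → s p ≺ s q

  singleton-chain : ∀ x → Chain {1} (λ _ → x)
  singleton-chain x zero zero ()

  snoc : ∀ {m} → (Fin m → A) → A → Fin (suc m) → A
  snoc {zero}  s x _       = x
  snoc {suc m} s x zero    = s zero
  snoc {suc m} s x (suc p) = snoc (s ∘ suc) x p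

  snoc-last : ∀ {m} (s : Fin m → A) x → snoc s x (fromℕ m) ≡ x
  snoc-last {zero}  s x = refl
  snoc-last {suc m} s x = snoc-last (s ∘ suc) x

  snoc-above : ∀ {m} (s : Fin m → A) {x y} →
               (∀ p → y ≺ s p) → y ≺ x → ∀ p → y ≺ snoc s x p
  snoc-above {zero}  s y≺s y≺x p       = y≺x
  snoc-above {suc m} s y≺s y≺x zero    = y≺s zero
  snoc-above {suc m} s y≺s y≺x (suc p) = snoc-above (s ∘ suc) (y≺s ∘ suc) y≺x p

  snoc-chain : ∀ {m} (s : Fin m → A) {x} →
               Chain s → (∀ p → s p ≺ x) → Chain (snoc s x)
  snoc-chain s cs s≺x zero zero ()
  snoc-chain s cs s≺x (suc p) zero ()
  snoc-chain {zero}  s cs s≺x zero (suc ())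
  snoc-chain {suc m} s cs s≺x zero (suc q) _ =
    snoc-above (s ∘ suc) (λ p → cs zero (suc p) z<s) (s≺x zero) q
  snoc-chain {suc m} s cs s≺x (suc p) (suc q) p<q =
    snoc-chain (s ∘ suc) (λ p' q' h → cs (suc p') (suc q') (s<s h)) (s≺x ∘ suc)
               p q (s<s⁻¹ p<q)

  below-last : ∀ {m} (s : Fin (suc m) → A) → Chain s →
               ∀ {x} → s (fromℕ m) ≺ x → ∀ p → s p ≺ x
  below-last {m} s cs last≺x p with p ≟ fromℕ m
  ... | yes refl   = last≺x
  ... | no p≢last  = ≺-trans (cs p (fromℕ m) (≤∧≢⇒< (≤fromℕ p) p≢last)) last≺x

  prefix-chain : ∀ {m m'} (s : Fin m → A) → Chain s → (m'≤m : m' ≤ m) →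
                 Chain (λ p → s (inject≤ p m'≤m))
  prefix-chain s cs m'≤m p q p<q =
    cs _ _ (subst₂ _<_ (sym (toℕ-inject≤ p m'≤m)) (sym (toℕ-inject≤ q m'≤m)) p<q)

  chain-length-bound : ∀ K → ¬ (Σ[ s ∈ (Fin (suc K) → A) ] Chain s) →
                       ∀ {m} (s : Fin m → A) → Chain s → m ≤ K
  chain-length-bound K no-long {m} s cs with m ≤? K
  ... | yes m≤K = m≤K
  ... | no  m≰K = ⊥-elim (no-long (_ , prefix-chain s cs (ℕ.≰⇒> m≰K)))

-- A subsequence of a whose positions increase and whose values increase for
-- ⊏; for ⊏ = _<_ resp. flip _<_ this is literally IsIncSubseq resp. IsDecSubseq.
Subseq : ∀ {n m} → (Fin n → Fin n) → (Fin n → Fin n → Set) → (Fin m → Fin n) → Set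
Subseq a _⊏_ s = (∀ p q → p <ᶠ q → s p <ᶠ s q) × (∀ p q → p <ᶠ q → a (s p) ⊏ a (s q))

IsLongestEndingAt : ∀ {n} → (Fin n → Fin n) → (Fin n → Fin n → Set) → Fin n → ℕ → Set
IsLongestEndingAt {n} a _⊏_ t i =
  (Σ[ s ∈ (Fin i → Fin n) ] (Subseq a _⊏_ s × EndsAt s t)) ×
  (∀ m (s : Fin m → Fin n) → Subseq a _⊏_ s → EndsAt s t → m ≤ i)

module Longest {n} (a : Fin n → Fin n) (_⊏_ : Fin n → Fin n → Set)
               (⊏-trans : Transitive _⊏_) where

  -- the step relation on positions whose chains are exactly the ⊏-subsequences
  _≺_ : Fin n → Fin n → Set
  x ≺ y = x <ᶠ y × a x ⊏ a y

  ≺-trans : Transitive _≺_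
  ≺-trans (x<y , ax⊏ay) (y<z , ay⊏az) = <ᶠ-trans x<y y<z , ⊏-trans ax⊏ay ay⊏az

  open Chains _≺_ ≺-trans

  subseq⇒chain : ∀ {m} {s : Fin m → Fin n} → Subseq a _⊏_ s → Chain s
  subseq⇒chain (pos , val) p q p<q = pos p q p<q , val p q p<q

  chain⇒subseq : ∀ {m} {s : Fin m → Fin n} → Chain s → Subseq a _⊏_ s
  chain⇒subseq cs = (λ p q p<q → proj₁ (cs p q p<q)) , (λ p q p<q → proj₂ (cs p q p<q))

  -- (1) in general form: a longest subsequence ending at t₁ extends to t₂
  longest-grows : ∀ {t₁ t₂ i₁ i₂} → t₁ <ᶠ t₂ → a t₁ ⊏ a t₂ →
                  IsLongestEndingAt a _⊏_ t₁ i₁ → IsLongestEndingAt a _⊏_ t₂ i₂ → i₁ < i₂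
  longest-grows {i₁ = zero}  _ _ ((_ , _ , ()) , _) _
  longest-grows {t₂ = t₂} {i₁ = suc m} t₁<t₂ at₁⊏at₂ ((s , sub , refl) , _) (_ , maximal) =
    maximal (suc (suc m)) (snoc s t₂)
      (chain⇒subseq (snoc-chain s (subseq⇒chain sub)
                       (below-last s (subseq⇒chain sub) (t₁<t₂ , at₁⊏at₂))))
      (snoc-last s t₂)

  -- every position is a subsequence of length 1 by itself
  longest-positive : ∀ {t i} → IsLongestEndingAt a _⊏_ t i → 1 ≤ i
  longest-positive {t} (_ , maximal) =
    maximal 1 (λ _ → t) (chain⇒subseq (singleton-chain t)) refl

  longest-bounded : ∀ K → ¬ (Σ[ s ∈ (Fin (suc K) → Fin n) ] Subseq a _⊏_ s) →
                    ∀ {t i} → IsLongestEndingAt a _⊏_ t i → i ≤ K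
  longest-bounded K no-long ((s , sub , _) , _) =
    chain-length-bound K (λ (s' , cs') → no-long (s' , chain⇒subseq cs')) s
                       (subseq⇒chain sub)

module LongestInc {n} (a : Fin n → Fin n) = Longest a _<ᶠ_ <ᶠ-trans
module LongestDec {n} (a : Fin n → Fin n) = Longest a (flip _<ᶠ_) (flip <ᶠ-trans)

module GridFunction {n} (a : Fin n → Fin n) (a-injective : Injective _≡_ _≡_ a)
                    (γ : Fin n → ℕ × ℕ) (isGrid : IsGridFunction a γ) where

  lds lis : Fin n → ℕ
  lds t = proj₁ (γ t)
  lis t = proj₂ (γ t)

  lis-grows : ∀ {t₁ t₂} → t₁ <ᶠ t₂ → a t₁ <ᶠ a t₂ → lis t₁ < lis t₂
  lis-grows {t₁} {t₂} t₁<t₂ v =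
    LongestInc.longest-grows a t₁<t₂ v (proj₂ (isGrid t₁)) (proj₂ (isGrid t₂))

  lds-grows : ∀ {t₁ t₂} → t₁ <ᶠ t₂ → a t₂ <ᶠ a t₁ → lds t₁ < lds t₂
  lds-grows {t₁} {t₂} t₁<t₂ v =
    LongestDec.longest-grows a t₁<t₂ v (proj₁ (isGrid t₁)) (proj₁ (isGrid t₂))

  grid-order : ∀ t₁ t₂ → lds t₂ ≤ lds t₁ → lis t₂ ≤ lis t₁ → t₂ ≤ᶠ t₁
  grid-order t₁ t₂ lds≤ lis≤ with <-cmp t₁ t₂
  ... | tri> _ _ t₂<t₁ = ℕ.<⇒≤ t₂<t₁
  ... | tri≈ _ refl _  = ℕ.≤-refl
  ... | tri< t₁<t₂ _ _ with <-cmp (a t₁) (a t₂)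
  ...   | tri< v _ _ = ⊥-elim (ℕ.<⇒≱ (lis-grows t₁<t₂ v) lis≤)
  ...   | tri≈ _ v _ = ⊥-elim (ℕ.<⇒≢ t₁<t₂ (cong toℕ (a-injective v)))
  ...   | tri> _ _ v = ⊥-elim (ℕ.<⇒≱ (lds-grows t₁<t₂ v) lds≤)

  γ-injective : ∀ {t t'} → γ t ≡ γ t' → t ≡ t'
  γ-injective {t} {t'} e = ≤ᶠ-antisym
    (grid-order t' t (ℕ.≤-reflexive (cong proj₁ e)) (ℕ.≤-reflexive (cong proj₂ e)))
    (grid-order t t' (ℕ.≤-reflexive (cong proj₁ (sym e))) (ℕ.≤-reflexive (cong proj₂ (sym e))))

  grid-order-strictˡ : ∀ t₁ t₂ → lds t₂ < lds t₁ → lis t₂ ≤ lis t₁ → t₂ <ᶠ t₁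
  grid-order-strictˡ t₁ t₂ lds< lis≤ =
    ≤∧≢⇒< (grid-order t₁ t₂ (ℕ.<⇒≤ lds<) lis≤) λ { refl → ℕ.<-irrefl refl lds< }

  grid-order-strictʳ : ∀ t₁ t₂ → lds t₂ ≤ lds t₁ → lis t₂ < lis t₁ → t₂ <ᶠ t₁
  grid-order-strictʳ t₁ t₂ lds≤ lis< =
    ≤∧≢⇒< (grid-order t₁ t₂ lds≤ (ℕ.<⇒≤ lis<)) λ { refl → ℕ.<-irrefl refl lis< }

  same-lds⇒increasing : ∀ {t₁ t₂} → t₁ <ᶠ t₂ → lds t₁ ≡ lds t₂ → a t₁ <ᶠ a t₂
  same-lds⇒increasing {t₁} {t₂} t₁<t₂ e with <-cmp (a t₁) (a t₂)
  ... | tri< v _ _ = v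
  ... | tri≈ _ v _ = ⊥-elim (ℕ.<⇒≢ t₁<t₂ (cong toℕ (a-injective v)))
  ... | tri> _ _ v = ⊥-elim (ℕ.<⇒≢ (lds-grows t₁<t₂ v) e)

  same-lis⇒decreasing : ∀ {t₁ t₂} → t₁ <ᶠ t₂ → lis t₁ ≡ lis t₂ → a t₂ <ᶠ a t₁
  same-lis⇒decreasing {t₁} {t₂} t₁<t₂ e with <-cmp (a t₁) (a t₂)
  ... | tri< v _ _ = ⊥-elim (ℕ.<⇒≢ (lis-grows t₁<t₂ v) e)
  ... | tri≈ _ v _ = ⊥-elim (ℕ.<⇒≢ t₁<t₂ (cong toℕ (a-injective v)))
  ... | tri> _ _ v = v

grid-index : ∀ {L} I → 1 ≤ I → I ≤ L → Σ[ i ∈ Fin L ] suc (toℕ i) ≡ I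
grid-index (suc I) _ I<L = fromℕ< I<L , cong suc (toℕ-fromℕ< I<L)

opposite-< : ∀ {L} {i i' : Fin L} → i <ᶠ i' → opposite i' <ᶠ opposite i
opposite-< {L} {i} {i'} i<i' =
  subst₂ _<_ (sym (opposite-prop i')) (sym (opposite-prop i))
         (ℕ.∸-monoʳ-< (s<s i<i') (toℕ<n i'))

module GridRanking (k ℓ : ℕ) (a : Fin (k * ℓ) → Fin (k * ℓ)) (a∈S : InS k ℓ a)
                   (γ : Fin (k * ℓ) → ℕ × ℕ) (isGrid : IsGridFunction a γ)
                   (R : Fin ℓ → Fin k → Fin (k * ℓ)) (isRank : IsGridRanking ℓ k γ R)
                   where

  open GridFunction a (proj₁ (proj₁ a∈S)) γ isGrid public

  lds-range : ∀ t → 1 ≤ lds t × lds t ≤ ℓ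
  lds-range t = LongestDec.longest-positive a (proj₁ (isGrid t)) ,
                LongestDec.longest-bounded a ℓ (proj₂ (proj₂ a∈S)) (proj₁ (isGrid t))

  lis-range : ∀ t → 1 ≤ lis t × lis t ≤ k
  lis-range t = LongestInc.longest-positive a (proj₂ (isGrid t)) ,
                LongestInc.longest-bounded a k (proj₁ (proj₂ a∈S)) (proj₂ (isGrid t))

  -- hence, γ being injective, every position is an entry of R
  R-surjective : ∀ t → Σ[ i ∈ Fin ℓ ] Σ[ j ∈ Fin k ] R i j ≡ t
  R-surjective t with lds-range t | lis-range t
  ... | 1≤lds , lds≤ℓ | 1≤lis , lis≤k
    with grid-index (lds t) 1≤lds lds≤ℓ | grid-index (lis t) 1≤lis lis≤k
  ... | i , i≡lds | j , j≡lis = i , j , γ-injective (trans (isRank i j) (cong₂ _,_ i≡lds j≡lis))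

  lds-R : ∀ i j → lds (R i j) ≡ suc (toℕ i)
  lds-R i j = cong proj₁ (isRank i j)

  lis-R : ∀ i j → lis (R i j) ≡ suc (toℕ j)
  lis-R i j = cong proj₂ (isRank i j)

  -- by (2), R increases along rows and down columns
  R-row : ∀ i j j' → j <ᶠ j' → R i j <ᶠ R i j'
  R-row i j j' j<j' = grid-order-strictʳ (R i j') (R i j)
    (ℕ.≤-reflexive (trans (lds-R i j) (sym (lds-R i j'))))
    (subst₂ _<_ (sym (lis-R i j)) (sym (lis-R i j')) (s<s j<j'))

  R-col : ∀ i i' j → i <ᶠ i' → R i j <ᶠ R i' j
  R-col i i' j i<i' = grid-order-strictˡ (R i' j) (R i j)
    (subst₂ _<_ (sym (lds-R i j)) (sym (lds-R i' j)) (s<s i<i'))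
    (ℕ.≤-reflexive (trans (lis-R i j) (sym (lis-R i' j))))

  R-in-Y : InY ℓ k R
  R-in-Y = R-surjective , R-row , R-col

  row-increasing : ∀ i → IsIncSubseq a (R i)
  row-increasing i = R-row i , λ j j' j<j' →
    same-lds⇒increasing (R-row i j j' j<j') (trans (lds-R i j) (sym (lds-R i j')))

  col-decreasing : ∀ j → IsDecSubseq a (λ i → R i j)
  col-decreasing j = (λ i i' → R-col i i' j) , λ i i' i<i' →
    same-lis⇒decreasing (R-col i i' j i<i') (trans (lis-R i j) (sym (lis-R i' j)))

  -- Part (5): rows of V are rows of R, columns of V are reversed columns of R
  V-in-Y : InY ℓ k (gridValuation a R)
  V-in-Y = V-surjective ,
           (λ i j j' j<j' → proj₂ (row-increasing (opposite i)) j j' j<j') ,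
           (λ i i' j i<i' → proj₂ (col-decreasing j) _ _ (opposite-< i<i'))
    where
    V-surjective : ∀ x → Σ[ i ∈ Fin ℓ ] Σ[ j ∈ Fin k ] gridValuation a R i j ≡ x
    V-surjective x with proj₂ (proj₁ a∈S) x
    ... | t , at≡x with R-surjective t
    ...   | i , j , Rij≡t = opposite i , j , (begin
      a (R (opposite (opposite i)) j) ≡⟨ cong (λ i' → a (R i' j)) (opposite-involutive i) ⟩
      a (R i j)                       ≡⟨ at≡x Rij≡t ⟩
      x                               ∎)
      where open ≡-Reasoning

valuation-determines : ∀ {n ℓ k} (a b : Fin n → Fin n) (R R' : Fin ℓ → Fin k → Fin n) →
  (∀ t → Σ[ i ∈ Fin ℓ ] Σ[ j ∈ Fin k ] R i j ≡ t) →
  (∀ i j → R i j ≡ R' i j) →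
  (∀ i j → gridValuation a R i j ≡ gridValuation b R' i j) →
  ∀ t → a t ≡ b t
valuation-determines a b R R' R-surjective R≡R' V≡V' t with R-surjective t
... | i , j , refl = begin
  a (R i j)                        ≡⟨ cong (λ i' → a (R i' j)) (opposite-involutive i) ⟨
  gridValuation a R (opposite i) j  ≡⟨ V≡V' (opposite i) j ⟩
  gridValuation b R' (opposite i) j ≡⟨ cong (λ i' → b (R' i' j)) (opposite-involutive i) ⟩
  b (R' i j)                       ≡⟨ cong b (R≡R' i j) ⟨
  b (R i j)                        ∎
  where open ≡-Reasoning

lemma3 : (k ℓ : ℕ) → 1 ≤ k → 1 ≤ ℓ →
    (a : Fin (k * ℓ) → Fin (k * ℓ)) → InS k ℓ a →
    (γ : Fin (k * ℓ) → ℕ × ℕ) → IsGridFunction a γ →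
    (R : Fin ℓ → Fin k → Fin (k * ℓ)) → IsGridRanking ℓ k γ R →
    -- (1)
    (∀ t₁ t₂ i₁ j₁ i₂ j₂ → γ t₁ ≡ (i₁ , j₁) → γ t₂ ≡ (i₂ , j₂) → t₁ <ᶠ t₂ →
       (a t₁ <ᶠ a t₂ → j₁ < j₂) × (a t₂ <ᶠ a t₁ → i₁ < i₂)) ×
    -- (2)
    (∀ t₁ t₂ i₁ j₁ i₂ j₂ → γ t₁ ≡ (i₁ , j₁) → γ t₂ ≡ (i₂ , j₂) →
       i₂ ≤ i₁ → j₂ ≤ j₁ → t₂ ≤ᶠ t₁) ×
    -- (3)
    InY ℓ k R ×
    -- (4)
    (∀ (i : Fin ℓ) (j : Fin k) →
       IsIncSubseq a (λ j' → R i j') × IsDecSubseq a (λ i' → R i' j)) ×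
    -- (5)
    InY ℓ k (gridValuation a R) ×
    -- (6) injectivity of φ (well-definedness is (3) and (5))
    (∀ (b : Fin (k * ℓ) → Fin (k * ℓ)) → InS k ℓ b →
       (γ' : Fin (k * ℓ) → ℕ × ℕ) → IsGridFunction b γ' →
       (R' : Fin ℓ → Fin k → Fin (k * ℓ)) → IsGridRanking ℓ k γ' R' →
       (∀ i j → R i j ≡ R' i j) →
       (∀ i j → gridValuation a R i j ≡ gridValuation b R' i j) →
       ∀ t → a t ≡ b t)
lemma3 k ℓ _ _ a a∈S γ isGrid R isRank =
  part1 , part2 , R-in-Y , (λ i j → row-increasing i , col-decreasing j) , V-in-Y ,
  λ b _ _ _ R' _ → valuation-determines a b R R' R-surjective
  where
  open GridRanking k ℓ a a∈S γ isGrid R isRank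

  part1 : ∀ t₁ t₂ i₁ j₁ i₂ j₂ → γ t₁ ≡ (i₁ , j₁) → γ t₂ ≡ (i₂ , j₂) → t₁ <ᶠ t₂ →
          (a t₁ <ᶠ a t₂ → j₁ < j₂) × (a t₂ <ᶠ a t₁ → i₁ < i₂)
  part1 t₁ t₂ _ _ _ _ refl refl t₁<t₂ = lis-grows t₁<t₂ , lds-grows t₁<t₂

  part2 : ∀ t₁ t₂ i₁ j₁ i₂ j₂ → γ t₁ ≡ (i₁ , j₁) → γ t₂ ≡ (i₂ , j₂) →
          i₂ ≤ i₁ → j₂ ≤ j₁ → t₂ ≤ᶠ t₁
  part2 t₁ t₂ _ _ _ _ refl refl = grid-order t₁ t₂
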